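{- Let $k>2$ be an integer and $\{U_n(k)\}_{n\ge0}$ defined by $U_0(k)=0$, $U_1(k)=1$, $U_{n+2}(k)=(4k+2)U_{n+1}(k)-U_n(k)$. Call a prime $p$ special if $p\mid k(k+1)$ and $p^2\mid U_p(k)$. Then $k(k+1)$ has an odd prime factor that is not special. -}

module Defs where

open import Data.Nat using (ℕ; zero; suc)
open import Data.Integer using (ℤ; +_; _+_; _*_; _-_)
open import Data.Integer.Divisibility using (_∣_)
open import Data.Nat.Primality using (Prime)
open import Data.Product using (_×_)

U : ℕ → ℤ → ℤ
U zero k = + 0
U (suc zero) k = + 1
U (suc (suc n)) k = (+ 4 * k + + 2) * U (suc n) k - U n k

Special : ℤ → ℕ → Set
Special k p = Prime p × ((+ p) ∣ (k * (k + + 1))) × ((+ p * + p) ∣ U p k)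

module Submission where

-- Write T n = C(n+1, 3).  Induction on the recursion gives the expansion
--   U n k ≡ n + 4 k T n   (mod k²),
-- and for a prime p ≥ 5 we have p ∣ T p = (p+1) p (p-1) / 6.  Hence p ∣ k forces
-- U p k ≡ p (mod p²), so p is not special.  Since U n (-(k+1)) = ± U n k, the same
-- holds when p ∣ k + 1: no prime p ≥ 5 dividing k(k+1) is special (module Congruence).
--
-- It remains to find, for k > 2, either such a prime or a reason why 3 is not special.
-- As U 3 k = 16 k(k+1) + 3, the prime 3 is non-special whenever 9 ∣ k(k+1), and also
-- for k = 3.  Let o be the odd one of k, k+1.  If o is prime to 3, or o = 3 o′ with
-- 1 < o′ prime to 3, then a prime factor of o resp. o′ is at least 5; if 9 ∣ o then
-- 9 ∣ k(k+1); and o = 3 forces k = 3 (module Witnesses).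

module Congruence where

  open import Defs
  open import Data.Nat as ℕ using (ℕ; zero; suc; _≤_; _<_)
  import Data.Nat.Properties as ℕₚ
  open import Data.Nat.Divisibility as ℕ∣ using (∣⇒≤)
  open import Data.Nat.Primality using (Prime; euclidsLemma; prime⇒nonTrivial)
  open import Data.Nat.Base using (nonTrivial⇒n>1)
  open import Data.Integer using (ℤ; +_; _+_; _*_; _-_; -_; ∣_∣; -1ℤ)
  open import Data.Integer.Properties using (∣-i∣≡∣i∣; abs-*; +-assoc)
  import Data.Integer.Divisibility as Unsigned
  open import Data.Integer.Divisibility.Signed
  open import Data.Integer.Tactic.RingSolver using (solve-∀)
  open import Data.Product using (∃; _×_; _,_)
  open import Data.Sum using (inj₁; inj₂)
  open import Relation.Nullary using (¬_; contradiction)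
  open import Relation.Nullary.Decidable using (from-no)
  open import Relation.Binary.PropositionalEquality
  open ≡-Reasoning

  -- T n = C(n+1, 3), introduced through the second-order recursion it satisfies.
  T : ℕ → ℤ
  T zero = + 0
  T (suc zero) = + 0
  T (suc (suc n)) = + suc n + + 2 * T (suc n) - T n

  six*T : ∀ n → + 6 * T n ≡ (+ n + + 1) * + n * (+ n - + 1)
  six*T zero = refl
  six*T (suc zero) = refl
  six*T (suc (suc n)) = begin
    + 6 * (+ 1 + N + + 2 * T (suc n) - T n)
      ≡⟨ distribute N (T (suc n)) (T n) ⟩
    + 6 * (+ 1 + N) + + 2 * (+ 6 * T (suc n)) - + 6 * T n
      ≡⟨ cong₂ (λ a b → + 6 * (+ 1 + N) + + 2 * a - b) (six*T (suc n)) (six*T n) ⟩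
    + 6 * (+ 1 + N) + + 2 * (cubic (+ 1 + N)) - cubic N
      ≡⟨ cubic-recursion N ⟩
    cubic (+ 1 + (+ 1 + N)) ∎
    where
    N : ℤ
    N = + n
    cubic : ℤ → ℤ
    cubic x = (x + + 1) * x * (x - + 1)
    distribute : ∀ N t₁ t₀ → + 6 * (+ 1 + N + + 2 * t₁ - t₀) ≡ + 6 * (+ 1 + N) + + 2 * (+ 6 * t₁) - + 6 * t₀
    distribute = solve-∀
    cubic-recursion : ∀ N → + 6 * (+ 1 + N) + + 2 * ((+ 1 + N + + 1) * (+ 1 + N) * (+ 1 + N - + 1)) - (N + + 1) * N * (N - + 1)
                            ≡ (+ 1 + (+ 1 + N) + + 1) * (+ 1 + (+ 1 + N)) * (+ 1 + (+ 1 + N) - + 1)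
    cubic-recursion = solve-∀

  U-expansion : ∀ n k → ∃ λ W → U n k ≡ + n + + 4 * k * T n + k * k * W
  U-expansion zero k = + 0 , base k
    where
    base : ∀ k → + 0 ≡ + 0 + + 4 * k * + 0 + k * k * + 0
    base = solve-∀
  U-expansion (suc zero) k = + 0 , base k
    where
    base : ∀ k → + 1 ≡ + 1 + + 4 * k * + 0 + k * k * + 0
    base = solve-∀
  U-expansion (suc (suc n)) k with U-expansion n k | U-expansion (suc n) k
  ... | W₀ , U₀≡ | W₁ , U₁≡ = + 16 * T (suc n) + (+ 4 * k + + 2) * W₁ - W₀ , (begin
    (+ 4 * k + + 2) * U (suc n) k - U n k
      ≡⟨ cong₂ (λ a b → (+ 4 * k + + 2) * a - b) U₁≡ U₀≡ ⟩
    (+ 4 * k + + 2) * (+ 1 + + n + + 4 * k * T (suc n) + k * k * W₁) - (+ n + + 4 * k * T n + k * k * W₀)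
      ≡⟨ recursion-step k (+ n) (T (suc n)) (T n) W₁ W₀ ⟩
    + 1 + (+ 1 + + n) + + 4 * k * (+ 1 + + n + + 2 * T (suc n) - T n)
      + k * k * (+ 16 * T (suc n) + (+ 4 * k + + 2) * W₁ - W₀) ∎)
    where
    recursion-step : ∀ k N t₁ t₀ w₁ w₀ →
      (+ 4 * k + + 2) * (+ 1 + N + + 4 * k * t₁ + k * k * w₁) - (N + + 4 * k * t₀ + k * k * w₀)
      ≡ + 1 + (+ 1 + N) + + 4 * k * (+ 1 + N + + 2 * t₁ - t₀) + k * k * (+ 16 * t₁ + (+ 4 * k + + 2) * w₁ - w₀)
    recursion-step = solve-∀

  n∣6*T : ∀ n → + n ∣ + 6 * T n
  n∣6*T n = subst (+ n ∣_) (sym (six*T n)) (∣m⇒∣m*n (+ n - + 1) (∣n⇒∣m*n (+ n + + 1) ∣-refl))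

  -- A prime p ≥ 5 is prime to 6, hence divides T p.
  prime∣T : ∀ {p} → Prime p → 5 ≤ p → + p ∣ T p
  prime∣T {p} prime[p] 5≤p
    with euclidsLemma 6 ∣ T p ∣ prime[p] (subst (p ℕ∣.∣_) (abs-* (+ 6) (T p)) (∣⇒∣ᵤ (n∣6*T p)))
  ... | inj₂ p∣T = ∣ᵤ⇒∣ p∣T
  ... | inj₁ p∣6 with euclidsLemma 2 3 prime[p] p∣6
  ...   | inj₁ p∣2 = contradiction (ℕₚ.≤-trans 5≤p (∣⇒≤ p∣2)) (from-no (5 ℕ.≤? 2))
  ...   | inj₂ p∣3 = contradiction (ℕₚ.≤-trans 5≤p (∣⇒≤ p∣3)) (from-no (5 ℕ.≤? 3))

  -- If p ≥ 5 is prime and p ∣ k, then U p k ≡ p (mod p²): both k T p and k² are divisible by p².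
  U≡p-mod-p² : ∀ {p} k → Prime p → 5 ≤ p → + p ∣ k →
    ∃ λ X → U p k ≡ + p + X × + p * + p ∣ X
  U≡p-mod-p² {p} k prime[p] 5≤p (divides a k≡a*p) with U-expansion p k | prime∣T prime[p] 5≤p
  ... | W , U≡ | divides b T≡b*p =
    + 4 * k * T p + k * k * W , trans U≡ (+-assoc (+ p) (+ 4 * k * T p) (k * k * W)) ,
    divides (+ 4 * a * b + a * a * W)
      (trans (cong₂ (λ x t → + 4 * x * t + x * x * W) k≡a*p T≡b*p) (factor-p² a b (+ p) W))
    where
    factor-p² : ∀ a b p W → + 4 * (a * p) * (b * p) + (a * p) * (a * p) * W ≡ (+ 4 * a * b + a * a * W) * (p * p)
    factor-p² = solve-∀

  p²∤p : ∀ {p} → 1 < p → ¬ (+ p * + p ∣ + p)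
  p²∤p {p} 1<p p²∣p = ℕₚ.<⇒≱ (ℕₚ.m<m*n p p 1<p) (∣⇒≤ (subst (ℕ∣._∣ p) (abs-* (+ p) (+ p)) (∣⇒∣ᵤ p²∣p)))
    where instance
      _ = ℕ.>-nonZero (ℕₚ.<-trans (ℕₚ.n<1+n 0) 1<p)

  p²∤U-of-p∣k : ∀ {p} k → Prime p → 5 ≤ p → + p ∣ k → ¬ (+ p * + p ∣ U p k)
  p²∤U-of-p∣k {p} k prime[p] 5≤p p∣k p²∣U =
    let (X , U≡p+X , p²∣X) = U≡p-mod-p² k prime[p] 5≤p p∣k
        p²∣p+X : + p * + p ∣ + p + X
        p²∣p+X = subst (+ p * + p ∣_) U≡p+X p²∣U
    in p²∤p (nonTrivial⇒n>1 p {{prime⇒nonTrivial prime[p]}}) (∣m+n∣n⇒∣m {+ p * + p} {+ p} {X} p²∣p+X p²∣X)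

  alternating : ℕ → ℤ
  alternating zero = -1ℤ
  alternating (suc n) = - alternating n

  ∣alternating∣ : ∀ n → ∣ alternating n ∣ ≡ 1
  ∣alternating∣ zero = refl
  ∣alternating∣ (suc n) = trans (∣-i∣≡∣i∣ (alternating n)) (∣alternating∣ n)

  -- The substitution k ↦ -(k+1) negates 4k+2, so it only changes the sign of U n k.
  U-reflection : ∀ n k → U n (- (k + + 1)) ≡ alternating n * U n k
  U-reflection zero k = refl
  U-reflection (suc zero) k = refl
  U-reflection (suc (suc n)) k = begin
    (+ 4 * (- (k + + 1)) + + 2) * U (suc n) (- (k + + 1)) - U n (- (k + + 1))
      ≡⟨ cong₂ (λ a b → (+ 4 * (- (k + + 1)) + + 2) * a - b) (U-reflection (suc n) k) (U-reflection n k) ⟩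
    (+ 4 * (- (k + + 1)) + + 2) * (- alternating n * U (suc n) k) - alternating n * U n k
      ≡⟨ sign-step (alternating n) k (U (suc n) k) (U n k) ⟩
    - (- alternating n) * ((+ 4 * k + + 2) * U (suc n) k - U n k) ∎
    where
    sign-step : ∀ s k u₁ u₀ → (+ 4 * (- (k + + 1)) + + 2) * (- s * u₁) - s * u₀ ≡ - (- s) * ((+ 4 * k + + 2) * u₁ - u₀)
    sign-step = solve-∀

  ∣U-reflection∣ : ∀ n k → ∣ U n (- (k + + 1)) ∣ ≡ ∣ U n k ∣
  ∣U-reflection∣ n k = begin
    ∣ U n (- (k + + 1)) ∣             ≡⟨ cong ∣_∣ (U-reflection n k) ⟩
    ∣ alternating n * U n k ∣         ≡⟨ abs-* (alternating n) (U n k) ⟩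
    ∣ alternating n ∣ ℕ.* ∣ U n k ∣   ≡⟨ cong (ℕ._* ∣ U n k ∣) (∣alternating∣ n) ⟩
    1 ℕ.* ∣ U n k ∣                   ≡⟨ ℕₚ.*-identityˡ ∣ U n k ∣ ⟩
    ∣ U n k ∣ ∎

  p²∤U : ∀ {p} k → Prime p → 5 ≤ p → + p Unsigned.∣ k * (k + + 1) → ¬ (+ p * + p Unsigned.∣ U p k)
  p²∤U {p} k prime[p] 5≤p p∣k[k+1] p²∣U
    with euclidsLemma ∣ k ∣ ∣ k + + 1 ∣ prime[p] (subst (p ℕ∣.∣_) (abs-* k (k + + 1)) p∣k[k+1])
  ... | inj₁ p∣k = p²∤U-of-p∣k k prime[p] 5≤p (∣ᵤ⇒∣ p∣k) (∣ᵤ⇒∣ p²∣U)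
  ... | inj₂ p∣k+1 = p²∤U-of-p∣k (- (k + + 1)) prime[p] 5≤p
        (∣ᵤ⇒∣ (subst (p ℕ∣.∣_) (sym (∣-i∣≡∣i∣ (k + + 1))) p∣k+1))
        (∣ᵤ⇒∣ (subst (∣ + p * + p ∣ ℕ∣.∣_) (sym (∣U-reflection∣ p k)) p²∣U))

module Witnesses where

  open Congruence using (p²∤U)
  open import Defs
  open import Data.Nat using (ℕ; suc; _+_; _*_; _≤_; _<_; s≤s; z≤n; _≤?_)
  open import Data.Nat.Properties using (≤-trans; <-irrefl; m≤m+n; +-monoˡ-≤; *-assoc; *-comm)
  open import Data.Nat.Divisibility using (_∣_; divides; _∣?_; ∣-trans; ∣m+n∣m⇒∣n; ∣n⇒∣m*n; m∣m*n; n∣m*n)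
  open import Data.Nat.Primality
    using (Prime; prime?; prime⇒nonTrivial; _Rough_; 2-rough; ∤⇒rough-suc; rough∧∣⇒rough; rough⇒≤)
  open import Data.Nat.Primality.Factorisation using (factorise)
  open import Data.Nat.ListAction using (product)
  open import Data.Integer as ℤ using (+_)
  open import Data.Integer.Properties using (abs-*; pos-*)
  import Data.Integer.Divisibility as ℤ∣
  open import Data.Integer.Tactic.RingSolver using (solve-∀)
  open import Data.List using ([]; _∷_)
  open import Data.List.Relation.Unary.All using (_∷_)
  open import Data.Product using (∃; _×_; _,_)
  open import Data.Sum using (_⊎_; inj₁; inj₂)
  open import Relation.Nullary using (¬_; yes; no; contradiction)
  open import Relation.Nullary.Decidable using (from-yes; from-no)
  open import Relation.Binary.PropositionalEquality

  NonSpecialOddFactor : ℕ → Set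
  NonSpecialOddFactor k =
    ∃ λ (p : ℕ) → Prime p × 2 < p × ((+ p) ℤ∣.∣ (+ k ℤ.* (+ k ℤ.+ + 1))) × ¬ Special (+ k) p

  ∣k[k+1]ᶻ : ∀ {p} k → p ∣ k * (k + 1) → + p ℤ∣.∣ + k ℤ.* (+ k ℤ.+ + 1)
  ∣k[k+1]ᶻ {p} k = subst (p ∣_) (sym (abs-* (+ k) (+ k ℤ.+ + 1)))

  prime-factor : ∀ {n} → 1 < n → ∃ λ p → Prime p × p ∣ n
  prime-factor {n@(suc _)} 1<n with factorise n
  ... | record { factors = [] ; isFactorisation = n≡1 } = contradiction 1<n (<-irrefl (sym n≡1))
  ... | record { factors = p ∷ ps ; isFactorisation = n≡p*ps ; factorsPrime = prime[p] ∷ _ } =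
    p , prime[p] , subst (p ∣_) (sym n≡p*ps) (m∣m*n (product ps))

  large-prime-factor : ∀ {n} → 1 < n → ¬ 2 ∣ n → ¬ 3 ∣ n → ∃ λ p → Prime p × 5 ≤ p × p ∣ n
  large-prime-factor {n} 1<n 2∤n 3∤n =
    let (p , prime[p] , p∣n) = prime-factor 1<n
    in p , prime[p] , rough⇒≤ {{prime⇒nonTrivial prime[p]}} (rough∧∣⇒rough 5-rough p∣n) , p∣n
    where
    4∤n : ¬ 4 ∣ n
    4∤n 4∣n = 2∤n (∣-trans (divides 2 refl) 4∣n)
    5-rough : 5 Rough n
    5-rough = ∤⇒rough-suc 4∤n (∤⇒rough-suc 3∤n (∤⇒rough-suc 2∤n 2-rough))

  coprime-to-6-witness : ∀ {k m} → m ∣ k * (k + 1) → 1 < m → ¬ 2 ∣ m → ¬ 3 ∣ m → NonSpecialOddFactor k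
  coprime-to-6-witness {k} m∣k[k+1] 1<m 2∤m 3∤m =
    let (p , prime[p] , 5≤p , p∣m) = large-prime-factor 1<m 2∤m 3∤m
        p∣k[k+1] : + p ℤ∣.∣ + k ℤ.* (+ k ℤ.+ + 1)
        p∣k[k+1] = ∣k[k+1]ᶻ k (∣-trans p∣m m∣k[k+1])
    in p , prime[p] , ≤-trans (s≤s (s≤s (s≤s z≤n))) 5≤p , p∣k[k+1] ,
       λ (_ , _ , p²∣U) → p²∤U (+ k) prime[p] 5≤p p∣k[k+1] p²∣U

  -- U 3 k = (4k+2)² - 1 = 16 k(k+1) + 3.
  ∣U₃∣ : ∀ k → ℤ.∣ U 3 (+ k) ∣ ≡ 16 * (k * (k + 1)) + 3
  ∣U₃∣ k = cong ℤ.∣_∣ (begin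
    U 3 (+ k)                                ≡⟨ U₃-identity (+ k) ⟩
    + 16 ℤ.* (+ k ℤ.* + (k + 1)) ℤ.+ + 3     ≡⟨ cong (λ x → + 16 ℤ.* x ℤ.+ + 3) (sym (pos-* k (k + 1))) ⟩
    + 16 ℤ.* + (k * (k + 1)) ℤ.+ + 3         ≡⟨ cong (ℤ._+ + 3) (sym (pos-* 16 (k * (k + 1)))) ⟩
    + (16 * (k * (k + 1)) + 3)               ∎)
    where
    open ≡-Reasoning
    U₃-identity : ∀ K → (+ 4 ℤ.* K ℤ.+ + 2) ℤ.* ((+ 4 ℤ.* K ℤ.+ + 2) ℤ.* + 1 ℤ.- + 0) ℤ.- + 1
                        ≡ + 16 ℤ.* (K ℤ.* (K ℤ.+ + 1)) ℤ.+ + 3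
    U₃-identity = solve-∀

  three-witness : ∀ {k} → 3 ∣ k * (k + 1) → ¬ 9 ∣ 16 * (k * (k + 1)) + 3 → NonSpecialOddFactor k
  three-witness {k} 3∣k[k+1] 9∤U₃ =
    3 , from-yes (prime? 3) , s≤s (s≤s (s≤s z≤n)) , ∣k[k+1]ᶻ k 3∣k[k+1] ,
    λ (_ , _ , 9∣U₃) → 9∤U₃ (subst (9 ∣_) (∣U₃∣ k) 9∣U₃)

  9∤16n+3 : ∀ {n} → 9 ∣ n → ¬ 9 ∣ 16 * n + 3
  9∤16n+3 9∣n 9∣16n+3 = from-no (9 ∣? 3) (∣m+n∣m⇒∣n 9∣16n+3 (∣n⇒∣m*n 16 9∣n))

  odd-member : ∀ k → ∃ λ o → (o ≡ k ⊎ o ≡ k + 1) × ¬ 2 ∣ o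
  odd-member k with 2 ∣? k
  ... | no 2∤k = k , inj₁ refl , 2∤k
  ... | yes 2∣k = k + 1 , inj₂ refl , λ 2∣k+1 → from-no (2 ∣? 1) (∣m+n∣m⇒∣n 2∣k+1 2∣k)

  witness-at-3 : NonSpecialOddFactor 3
  witness-at-3 = three-witness (divides 4 refl) (from-no (9 ∣? 195))

  member∣k[k+1] : ∀ {k o} → (o ≡ k ⊎ o ≡ k + 1) → o ∣ k * (k + 1)
  member∣k[k+1] {k} (inj₁ refl) = m∣m*n (k + 1)
  member∣k[k+1] {k} (inj₂ refl) = n∣m*n k

  member>2 : ∀ {k o} → 2 < k → (o ≡ k ⊎ o ≡ k + 1) → 2 < o
  member>2 2<k (inj₁ refl) = 2<k
  member>2 {k} 2<k (inj₂ refl) = ≤-trans 2<k (m≤m+n k 1)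

  nine-witness : ∀ {k} → 9 ∣ k * (k + 1) → NonSpecialOddFactor k
  nine-witness 9∣k[k+1] = three-witness (∣-trans (divides 3 refl) 9∣k[k+1]) (9∤16n+3 9∣k[k+1])

  -- An odd member o = 3 o′ of {k, k+1} with 3 ∤ o′: either o′ > 1 is prime to 6,
  -- or o = 3, which for k > 2 means k = 3.
  cofactor-witness : ∀ {k o} → 2 < k → (o ≡ k ⊎ o ≡ k + 1) → ¬ 2 ∣ o →
    ∀ o′ → o ≡ o′ * 3 → ¬ 3 ∣ o′ → NonSpecialOddFactor k
  cofactor-witness 2<k o∈ 2∤o 0 o≡0 _ = contradiction (divides 0 o≡0) 2∤o
  cofactor-witness 2<k (inj₁ refl) 2∤o 1 refl _ = witness-at-3
  cofactor-witness {k} 2<k (inj₂ 3≡k+1) 2∤o 1 refl _ =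
    contradiction (subst (4 ≤_) (sym 3≡k+1) (+-monoˡ-≤ 1 2<k)) (from-no (4 ≤? 3))
  cofactor-witness {o = o} 2<k o∈ 2∤o o′@(suc (suc _)) o≡o′*3 3∤o′ =
    coprime-to-6-witness (∣-trans o′∣o (member∣k[k+1] o∈)) (s≤s (s≤s z≤n)) (λ 2∣o′ → 2∤o (∣-trans 2∣o′ o′∣o)) 3∤o′
    where
    o′∣o : o′ ∣ o
    o′∣o = divides 3 (trans o≡o′*3 (*-comm o′ 3))

  witness-from-odd-member : ∀ {k o} → 2 < k → (o ≡ k ⊎ o ≡ k + 1) → ¬ 2 ∣ o → NonSpecialOddFactor k
  witness-from-odd-member {k} {o} 2<k o∈ 2∤o with 3 ∣? o
  ... | no 3∤o = coprime-to-6-witness (member∣k[k+1] o∈) (≤-trans (s≤s (s≤s z≤n)) (member>2 2<k o∈)) 2∤o 3∤o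
  ... | yes (divides o′ o≡o′*3) with 3 ∣? o′
  ...   | no 3∤o′ = cofactor-witness 2<k o∈ 2∤o o′ o≡o′*3 3∤o′
  ...   | yes (divides o″ o′≡o″*3) = nine-witness (∣-trans (divides o″ o≡o″*9) (member∣k[k+1] o∈))
    where
    o≡o″*9 : o ≡ o″ * 9
    o≡o″*9 = trans o≡o′*3 (trans (cong (_* 3) o′≡o″*3) (*-assoc o″ 3 3))

  non-special-odd-factor : ∀ k → 2 < k → NonSpecialOddFactor k
  non-special-odd-factor k 2<k =
    let (o , o∈ , 2∤o) = odd-member k in witness-from-odd-member 2<k o∈ 2∤o

open import Defs
open import Data.Nat using (ℕ; _<_)
open import Data.Integer using (ℤ; +_; _+_; _*_)
open import Data.Integer.Divisibility using (_∣_)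
open import Data.Nat.Primality using (Prime)
open import Data.Product using (∃; _×_)
open import Relation.Nullary using (¬_)

lemma18 : (k : ℕ) → 2 < k →
    ∃ λ (p : ℕ) → Prime p × 2 < p × ((+ p) ∣ (+ k * (+ k + + 1))) × ¬ Special (+ k) p
lemma18 k 2<k = Witnesses.non-special-odd-factor k 2<k
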